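{- In an application of Res in which the main premise is a query clause $Q$ and the side premises are loosely guarded clauses (LGCs), there is no variable depth growth in the resolvent; in particular the resolvent is a simple clause.
   Context: $var(E)$: variables of $E$. Variable depth: $vdp(t)=-1$ if $t$ ground, $0$ if a variable, $1+\max_i vdp(u_i)$ for non-ground $f(u_1,\dots,u_n)$. Flat: $vdp\le0$; simple: $vdp\le1$ (atoms/literals/clauses: all terms). A non-ground compound literal contains a non-ground compound term. A compound term $t$ is weakly covering if $var(s)=var(t)$ for each non-ground compound subterm $s$; a clause $C$ (resp. literal $L$) is weakly covering if each of its terms is ground, a variable, or weakly covering $t$ with $var(t)=var(C)$ (resp. $var(L)$). LGC: a simple, weakly covering clause which, if non-ground, contains flat negative literals (guards) $\lnot G_1,\dots,\lnot G_m$ such that each pair of its variables co-occurs in some $G_j$. Query clause: the negation $\lnot q$ of a Boolean conjunctive query $q=\exists\overline x\,\varphi(\overline x)$, $\varphi$ a conjunction of atoms with only variables and constants as arguments; thus a negative clause with no compound terms. Query pair: flat, non-ground atoms $A_1,\dots,A_n$ and weakly covering simple atoms $B_1,\dots,B_n$, each non-ground compound or ground, $var(\overline A)\cap var(\overline B)=\emptyset$, $B_i$ pairwise variable-disjoint, with simultaneous mgu $\sigma_0$ of $A_i=B_i$ (all $i$). Query pair clauses: $C=\lnot A_1\lor\dots\lor\lnot A_n\lor D$ ($D$ flat), $C_i=B_i\lor D_i$ ($D_i$ simple). Top variable: $x\in var(\overline A)$ with $vdp(x\sigma_0)\ge vdp(y\sigma_0)$ for all $y\in var(\overline A)$. Res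 (with refinement LGC-Refine: side premises have no selected literal and $B_i$ strictly maximal w.r.t. a lexicographic path ordering with precedence function symbols $>$ constants $>$ predicate symbols): reorder so that $A_1,\dots,A_t$ are exactly the atoms containing a top variable; with $\sigma$ an mgu of $A_i=B_i$ ($i\le t$), derive $(D_1\lor\dots\lor D_t\lor\lnot A_{t+1}\lor\dots\lor\lnot A_n\lor D)\sigma$ from $C,C_1,\dots,C_t$. No variable depth growth means the maximal variable depth of terms in the resolvent does not exceed that of the premises. -}

module Defs where

open import Data.Nat using (ℕ; zero; suc; _>_)
open import Data.Integer using (ℤ; -1ℤ; 0ℤ; 1ℤ; _⊔_) renaming (_+_ to _+ℤ_; _≤_ to _≤ℤ_)
open import Data.Bool using (Bool; true; false; if_then_else_)
open import Data.List using (List; []; _∷_; _++_; map; concatMap; null; foldr)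
open import Data.List.Membership.Propositional using (_∈_)
open import Data.List.Relation.Unary.Any using (Any)
open import Data.List.Relation.Unary.All using (All)
open import Data.Vec using (Vec; toList) renaming ([] to []ᵥ; _∷_ to _∷ᵥ_)
import Data.Vec.Membership.Propositional as VM
open import Data.Fin using (Fin)
open import Data.List using (allFin)
open import Data.Sum using (_⊎_; inj₁; inj₂)
open import Data.Product using (_×_; Σ; ∃; ∃-syntax; _,_)
open import Data.Empty using (⊥)
open import Data.Unit using (⊤)
open import Relation.Nullary using (¬_)
open import Relation.Binary.PropositionalEquality using (_≡_; _≢_)

record Signature : Set₁ where
  field
    FSym   : Set
    fArity : FSym → ℕ
    PSym   : Set
    pArity : PSym → ℕ

module Over (S : Signature) where
  open Signature S

  Var : Set
  Var = ℕ

  data Term : Set where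
    var : Var → Term
    fun : (f : FSym) → Vec Term (fArity f) → Term

  data Atom : Set where
    pred : (p : PSym) → Vec Term (pArity p) → Atom

  data Literal : Set where
    pos : Atom → Literal
    neg : Atom → Literal

  -- clauses as (multi)sets of literals, represented by lists
  Clause : Set
  Clause = List Literal

  mutual
    varsT : Term → List Var
    varsT (var x)    = x ∷ []
    varsT (fun f ts) = varsV ts

    varsV : ∀ {k} → Vec Term k → List Var
    varsV []ᵥ       = []
    varsV (t ∷ᵥ ts) = varsT t ++ varsV ts

  argsA : Atom → List Term
  argsA (pred p ts) = toList ts

  atomOf : Literal → Atom
  atomOf (pos a) = a
  atomOf (neg a) = a

  varsA : Atom → List Var
  varsA (pred p ts) = varsV ts

  varsL : Literal → List Var
  varsL l = varsA (atomOf l)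

  varsC : Clause → List Var
  varsC = concatMap varsL

  termsL : Literal → List Term
  termsL l = argsA (atomOf l)

  termsC : Clause → List Term
  termsC = concatMap termsL

  SameVars : List Var → List Var → Set
  SameVars xs ys = ∀ x → (x ∈ xs → x ∈ ys) × (x ∈ ys → x ∈ xs)

  Disjoint : List Var → List Var → Set
  Disjoint xs ys = ∀ x → x ∈ xs → x ∈ ys → ⊥

  Ground : Term → Set
  Ground t = varsT t ≡ []

  GroundA : Atom → Set
  GroundA a = varsA a ≡ []

  GroundC : Clause → Set
  GroundC c = varsC c ≡ []

  IsVar : Term → Set
  IsVar (var _)   = ⊤
  IsVar (fun _ _) = ⊥

  Compound : Term → Set
  Compound (var _)   = ⊥
  Compound (fun _ _) = ⊤

  IsConstant : Term → Set
  IsConstant (var _)   = ⊥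
  IsConstant (fun f _) = fArity f ≡ 0

  data _⊴_ : Term → Term → Set where
    here   : ∀ {t} → t ⊴ t
    inside : ∀ {s t f ts} → t VM.∈ ts → s ⊴ t → s ⊴ fun f ts

  mutual
    vdp : Term → ℤ
    vdp (var x)    = 0ℤ
    vdp (fun f ts) = if null (varsV ts) then -1ℤ else 1ℤ +ℤ vdpV ts

    vdpV : ∀ {k} → Vec Term k → ℤ
    vdpV []ᵥ       = -1ℤ
    vdpV (t ∷ᵥ ts) = vdp t ⊔ vdpV ts

  vdpC : Clause → ℤ
  vdpC c = foldr _⊔_ -1ℤ (map vdp (termsC c))

  FlatA : Atom → Set
  FlatA a = All (λ t → vdp t ≤ℤ 0ℤ) (argsA a)

  SimpleA : Atom → Set
  SimpleA a = All (λ t → vdp t ≤ℤ 1ℤ) (argsA a)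

  FlatL : Literal → Set
  FlatL l = FlatA (atomOf l)

  FlatC : Clause → Set
  FlatC c = All (λ t → vdp t ≤ℤ 0ℤ) (termsC c)

  SimpleC : Clause → Set
  SimpleC c = All (λ t → vdp t ≤ℤ 1ℤ) (termsC c)

  NonGroundCompoundA : Atom → Set
  NonGroundCompoundA a = Any (λ t → Compound t × ¬ Ground t) (argsA a)

  WeaklyCoveringT : Term → Set
  WeaklyCoveringT t =
    Compound t ×
    (∀ s → s ⊴ t → Compound s → ¬ Ground s → SameVars (varsT s) (varsT t))

  CoveredIn : List Var → Term → Set
  CoveredIn V t = Ground t ⊎ IsVar t ⊎ (WeaklyCoveringT t × SameVars (varsT t) V)

  WeaklyCoveringL : Literal → Set
  WeaklyCoveringL l = All (CoveredIn (varsL l)) (termsL l)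

  WeaklyCoveringA : Atom → Set
  WeaklyCoveringA a = WeaklyCoveringL (pos a)

  WeaklyCoveringC : Clause → Set
  WeaklyCoveringC c = All (CoveredIn (varsC c)) (termsC c)

  IsNeg : Literal → Set
  IsNeg (pos _) = ⊥
  IsNeg (neg _) = ⊤

  LGC : Clause → Set
  LGC c =
    SimpleC c × WeaklyCoveringC c ×
    (¬ GroundC c →
      ∀ x y → x ∈ varsC c → y ∈ varsC c →
        ∃[ g ] (g ∈ c × IsNeg g × FlatL g × x ∈ varsL g × y ∈ varsL g))

  QueryClause : Clause → Set
  QueryClause c =
    All IsNeg c × All (λ t → IsVar t ⊎ IsConstant t) (termsC c)

  Subst : Set
  Subst = Var → Term

  mutual
    subT : Subst → Term → Term
    subT σ (var x)    = σ x
    subT σ (fun f ts) = fun f (subV σ ts)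

    subV : ∀ {k} → Subst → Vec Term k → Vec Term k
    subV σ []ᵥ       = []ᵥ
    subV σ (t ∷ᵥ ts) = subT σ t ∷ᵥ subV σ ts

  subA : Subst → Atom → Atom
  subA σ (pred p ts) = pred p (subV σ ts)

  subL : Subst → Literal → Literal
  subL σ (pos a) = pos (subA σ a)
  subL σ (neg a) = neg (subA σ a)

  subC : Subst → Clause → Clause
  subC σ = map (subL σ)

  UnifiesOn : ∀ {n} → (Fin n → Set) → (Fin n → Atom) → (Fin n → Atom) → Subst → Set
  UnifiesOn P A B σ = ∀ i → P i → subA σ (A i) ≡ subA σ (B i)

  MGUOn : ∀ {n} → (Fin n → Set) → (Fin n → Atom) → (Fin n → Atom) → Subst → Set
  MGUOn P A B σ =
    UnifiesOn P A B σ ×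
    (∀ θ → UnifiesOn P A B θ → ∃[ δ ] (∀ x → θ x ≡ subT δ (σ x)))

  varsAs : ∀ {n} → (Fin n → Atom) → List Var
  varsAs {n} A = concatMap (λ i → varsA (A i)) (allFin n)

  record QueryPair {n} (A B : Fin n → Atom) (σ₀ : Subst) : Set where
    field
      A-flat       : ∀ i → FlatA (A i)
      A-nonground  : ∀ i → ¬ GroundA (A i)
      B-wc         : ∀ i → WeaklyCoveringA (B i)
      B-simple     : ∀ i → SimpleA (B i)
      B-shape      : ∀ i → NonGroundCompoundA (B i) ⊎ GroundA (B i)
      AB-disjoint  : Disjoint (varsAs A) (varsAs B)
      B-disjoint   : ∀ i j → i ≢ j → Disjoint (varsA (B i)) (varsA (B j))
      mgu₀         : MGUOn (λ _ → ⊤) A B σ₀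

  mainPremise : ∀ {n} → (Fin n → Atom) → Clause → Clause
  mainPremise {n} A D = map (λ i → neg (A i)) (allFin n) ++ D

  sidePremise : ∀ {n} → (Fin n → Atom) → (Fin n → Clause) → Fin n → Clause
  sidePremise B Ds i = pos (B i) ∷ Ds i

  TopVar : ∀ {n} → (Fin n → Atom) → Subst → Var → Set
  TopVar A σ₀ x = x ∈ varsAs A × (∀ y → y ∈ varsAs A → vdp (σ₀ y) ≤ℤ vdp (σ₀ x))

  ContainsTopVar : ∀ {n} → (Fin n → Atom) → Subst → Fin n → Set
  ContainsTopVar A σ₀ i = ∃[ x ] (x ∈ varsA (A i) × TopVar A σ₀ x)

  -- the resolvent of Res, where T selects the atoms A_1,…,A_t
  resolvent : ∀ {n} → (Fin n → Atom) → Clause → (Fin n → Clause) →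
              (Fin n → Bool) → Subst → Clause
  resolvent {n} A D Ds T σ =
    subC σ (concatMap (λ i → if T i then Ds i else []) (allFin n)
            ++ concatMap (λ i → if T i then [] else neg (A i) ∷ []) (allFin n)
            ++ D)

  premises : ∀ {n} → (Fin n → Atom) → (Fin n → Atom) → Clause → (Fin n → Clause) →
             (Fin n → Bool) → Clause
  premises {n} A B D Ds T =
    mainPremise A D ++
    concatMap (λ i → if T i then sidePremise B Ds i else []) (allFin n)

  -- lexicographic path ordering on atoms (atoms treated as terms whose
  -- head is a predicate symbol), for a precedence on symbols

  Sym : Set
  Sym = FSym ⊎ PSym

  data LTerm : Set where
    lvar : Var → LTerm
    lapp : Sym → List LTerm → LTerm

  mutual
    embT : Term → LTerm
    embT (var x)    = lvar x
    embT (fun f ts) = lapp (inj₁ f) (embV ts)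

    embV : ∀ {k} → Vec Term k → List LTerm
    embV []ᵥ       = []
    embV (t ∷ᵥ ts) = embT t ∷ embV ts

  embA : Atom → LTerm
  embA (pred p ts) = lapp (inj₂ p) (embV ts)

  record Precedence (_≻_ : Sym → Sym → Set) : Set where
    field
      irrefl   : ∀ s → ¬ (s ≻ s)
      trans    : ∀ {a b c} → a ≻ b → b ≻ c → a ≻ c
      fun>const  : ∀ f c → fArity f > 0 → fArity c ≡ 0 → inj₁ f ≻ inj₁ c
      const>pred : ∀ c p → fArity c ≡ 0 → inj₁ c ≻ inj₂ p

  module LPO (_≻_ : Sym → Sym → Set) where
    mutual
      data _≻ₗ_ : LTerm → LTerm → Set where
        lpo-sub  : ∀ {f ss t} → Any (λ s → s ≽ₗ t) ss → lapp f ss ≻ₗ t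
        lpo-prec : ∀ {f g ss ts} → f ≻ g → All (λ t → lapp f ss ≻ₗ t) ts →
                   lapp f ss ≻ₗ lapp g ts
        lpo-lex  : ∀ {f ss ts} → Lex ss ts → All (λ t → lapp f ss ≻ₗ t) ts →
                   lapp f ss ≻ₗ lapp f ts

      data _≽ₗ_ : LTerm → LTerm → Set where
        gt : ∀ {s t} → s ≻ₗ t → s ≽ₗ t
        eq : ∀ {s} → s ≽ₗ s

      data Lex : List LTerm → List LTerm → Set where
        lex-head : ∀ {s t ss ts} → s ≻ₗ t → Lex (s ∷ ss) (t ∷ ts)
        lex-tail : ∀ {s ss ts} → Lex ss ts → Lex (s ∷ ss) (s ∷ ts)

    _≻ₐ_ : Atom → Atom → Set
    a ≻ₐ b = embA a ≻ₗ embA b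

    _≽ₐ_ : Atom → Atom → Set
    a ≽ₐ b = embA a ≽ₗ embA b

    -- extension to literals (multiset extension, A ↦ {A}, ¬A ↦ {A,A})
    data _≻L_ : Literal → Literal → Set where
      pp : ∀ {a b} → a ≻ₐ b → pos a ≻L pos b
      nn : ∀ {a b} → a ≻ₐ b → neg a ≻L neg b
      np : ∀ {a b} → a ≽ₐ b → neg a ≻L pos b
      pn : ∀ {a b} → a ≻ₐ b → pos a ≻L neg b

    StrictlyMaximal : Literal → Clause → Set
    StrictlyMaximal l d = ∀ l' → l' ∈ d → ¬ (l' ≻L l) × l' ≢ l

  LGCRefine : (Sym → Sym → Set) → (Clause → List Literal) → Atom → Clause → Set
  LGCRefine _≻_ sel b d =
    sel (pos b ∷ d) ≡ [] × LPO.StrictlyMaximal _≻_ (pos b) d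

module Submission where

-- Every term of the resolvent is σ t for a term t of a premise, so it suffices to control σ on
-- variables.  Variables outside the selected equations A_i = B_i are sent to variables by the mgu σ.
-- If the simultaneous unifier σ₀ maps every variable of the A_i to a ground term, so does σ on the
-- selected equations.  Otherwise let d be the σ₀-depth of a top variable: every selected B_i has a
-- weakly covering argument of σ₀-depth d, all variables of B_i have σ₀-depth below d and all compound
-- arguments of B_i σ₀-depth at least d.  Writing σ₀ = δ₀ ∘ σ, cut each term s in the range of σ down
-- to its head symbol over collapsed arguments when δ₀ s is at least d deep, and to a variable (unless
-- ground) otherwise.  This yields another unifier of the selected equations, so σ, being most general,
-- maps every variable of a selected B_i to a variable or a ground term.  By weak covering the compound
-- terms of the side premises only contain such variables, hence σ does not deepen them, and a variable
-- of A_i is sent to the σ-image of its partner argument in B_i, which is no deeper than that argument.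

open import Defs
open import Data.Nat using (ℕ; z≤n) renaming (_≟_ to _≟ℕ_)
open import Data.Integer as ℤ using (ℤ; -1ℤ; 0ℤ; 1ℤ; _⊔_; +≤+) renaming (_≤_ to _≤ℤ_; suc to sucℤ)
import Data.Integer.Properties as ℤ
open import Data.Bool using (Bool; true; false; if_then_else_)
open import Data.List using (List; []; _∷_; _++_; map; concatMap; null; foldr; allFin; zip)
open import Data.List.Membership.Propositional using (_∈_; _∉_; find; lose)
open import Data.List.Membership.Propositional.Properties
  using (∈-++⁺ˡ; ∈-++⁺ʳ; ∈-++⁻; ∈-map⁺; ∈-map⁻; ∈-concatMap⁺; ∈-concatMap⁻; ∈-allFin)
open import Data.List.Membership.DecPropositional _≟ℕ_ using (_∈?_)
open import Data.List.Relation.Unary.Any using (here; there)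
open import Data.List.Relation.Unary.All as All using (All)
open import Data.Vec as V using (Vec; toList) renaming ([] to []ᵥ; _∷_ to _∷ᵥ_)
open import Data.List.Properties using (++-conicalˡ; ++-conicalʳ; ∷-injectiveˡ; ∷-injectiveʳ)
open import Data.Fin using (Fin)
open import Data.Sum using (_⊎_; inj₁; inj₂; [_,_]′)
open import Data.Product using (_×_; Σ-syntax; ∃-syntax; _,_; proj₁; proj₂)
open import Data.Empty using (⊥-elim)
open import Data.Unit using (tt)
open import Function.Bundles using (_⇔_; Equivalence)
open import Relation.Nullary using (¬_; yes; no)
open import Relation.Binary.PropositionalEquality

∈-concatMap-intro : ∀ {A B : Set} {f : A → List B} {x xs y} → x ∈ xs → y ∈ f x → y ∈ concatMap f xs
∈-concatMap-intro {f = f} x∈xs y∈fx = ∈-concatMap⁺ f (lose x∈xs y∈fx)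

∈-concatMap-elim : ∀ {A B : Set} {f : A → List B} {xs y} → y ∈ concatMap f xs → ∃[ x ] (x ∈ xs × y ∈ f x)
∈-concatMap-elim {f = f} {xs} y∈ = find (∈-concatMap⁻ f {xs = xs} y∈)

≡[]⊎∈ : ∀ {A : Set} (xs : List A) → xs ≡ [] ⊎ ∃[ x ] x ∈ xs
≡[]⊎∈ []       = inj₁ refl
≡[]⊎∈ (x ∷ xs) = inj₂ (x , here refl)

∉-≡[] : ∀ {A : Set} {x : A} {xs} → xs ≡ [] → x ∉ xs
∉-≡[] refl ()

∈-zip⁻ : ∀ {A B : Set} (xs : List A) (ys : List B) {x y} → (x , y) ∈ zip xs ys → x ∈ xs × y ∈ ys
∈-zip⁻ (x ∷ xs) (y ∷ ys) (here refl) = here refl , here refl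
∈-zip⁻ (_ ∷ xs) (_ ∷ ys) (there xy∈) = let x∈ , y∈ = ∈-zip⁻ xs ys xy∈ in there x∈ , there y∈

map-≡⇒zip-≡ : ∀ {A B : Set} (f : A → B) (xs ys : List A) {x y} → map f xs ≡ map f ys →
              (x , y) ∈ zip xs ys → f x ≡ f y
map-≡⇒zip-≡ f (x ∷ xs) (y ∷ ys) eq (here refl) = ∷-injectiveˡ eq
map-≡⇒zip-≡ f (_ ∷ xs) (_ ∷ ys) eq (there xy∈) = map-≡⇒zip-≡ f xs ys (∷-injectiveʳ eq) xy∈

∈-zip-partnerˡ : ∀ {A B : Set} {k} (xs : Vec A k) (ys : Vec B k) {x} → x ∈ toList xs →
                 ∃[ y ] (x , y) ∈ zip (toList xs) (toList ys)
∈-zip-partnerˡ (x ∷ᵥ xs) (y ∷ᵥ ys) (here refl) = y , here refl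
∈-zip-partnerˡ (_ ∷ᵥ xs) (_ ∷ᵥ ys) (there x∈)  = let y , xy∈ = ∈-zip-partnerˡ xs ys x∈ in y , there xy∈

∈-zip-partnerʳ : ∀ {A B : Set} {k} (xs : Vec A k) (ys : Vec B k) {y} → y ∈ toList ys →
                 ∃[ x ] (x , y) ∈ zip (toList xs) (toList ys)
∈-zip-partnerʳ (x ∷ᵥ xs) (y ∷ᵥ ys) (here refl) = x , here refl
∈-zip-partnerʳ (_ ∷ᵥ xs) (_ ∷ᵥ ys) (there y∈)  = let x , xy∈ = ∈-zip-partnerʳ xs ys y∈ in x , there xy∈

∈-if-true⁻ : ∀ {X : Set} b {xs : List X} {x} → x ∈ (if b then xs else []) → b ≡ true × x ∈ xs
∈-if-true⁻ true x∈ = refl , x∈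

∈-if-false⁻ : ∀ {X : Set} b {xs : List X} {x} → x ∈ (if b then [] else xs) → b ≡ false × x ∈ xs
∈-if-false⁻ false x∈ = refl , x∈

∈-if-true⁺ : ∀ {X : Set} {b} {xs : List X} {x} → b ≡ true → x ∈ xs → x ∈ (if b then xs else [])
∈-if-true⁺ refl x∈ = x∈

0≤1 : 0ℤ ≤ℤ 1ℤ
0≤1 = +≤+ z≤n

0≰-1 : ¬ 0ℤ ≤ℤ -1ℤ
0≰-1 ()

suc[i]≰i : ∀ {i} → ¬ sucℤ i ≤ℤ i
suc[i]≰i le = ℤ.i≮i (ℤ.suc[i]≤j⇒i<j le)

suc-cancel-≤ : ∀ {i j} → sucℤ i ≤ℤ sucℤ j → i ≤ℤ j
suc-cancel-≤ {i} {j} le = subst (i ≤ℤ_) (ℤ.pred-suc j) (ℤ.i<j⇒i≤pred[j] (ℤ.suc[i]≤j⇒i<j le))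

module _ (S : Signature) where
  open Signature S
  open Over S

  ∈-varsV⁻ : ∀ {x k} (ts : Vec Term k) → x ∈ varsV ts → ∃[ t ] (t ∈ toList ts × x ∈ varsT t)
  ∈-varsV⁻ (t ∷ᵥ ts) x∈ with ∈-++⁻ (varsT t) x∈
  ... | inj₁ x∈t  = t , here refl , x∈t
  ... | inj₂ x∈ts = let u , u∈ , x∈u = ∈-varsV⁻ ts x∈ts in u , there u∈ , x∈u

  ∈-varsV⁺ : ∀ {x t k} (ts : Vec Term k) → t ∈ toList ts → x ∈ varsT t → x ∈ varsV ts
  ∈-varsV⁺ (t ∷ᵥ ts) (here refl) x∈t = ∈-++⁺ˡ x∈t
  ∈-varsV⁺ (u ∷ᵥ ts) (there t∈)  x∈t = ∈-++⁺ʳ (varsT u) (∈-varsV⁺ ts t∈ x∈t)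

  ∈-varsA⁻ : ∀ a {x} → x ∈ varsA a → ∃[ t ] (t ∈ argsA a × x ∈ varsT t)
  ∈-varsA⁻ (pred p ts) = ∈-varsV⁻ ts

  ∈-varsA⁺ : ∀ a {x t} → t ∈ argsA a → x ∈ varsT t → x ∈ varsA a
  ∈-varsA⁺ (pred p ts) = ∈-varsV⁺ ts

  mutual
    subT-ground : ∀ ρ t → Ground t → subT ρ t ≡ t
    subT-ground ρ (var x)    ()
    subT-ground ρ (fun f ts) g = cong (fun f) (subV-ground ρ ts g)

    subV-ground : ∀ ρ {k} (ts : Vec Term k) → varsV ts ≡ [] → subV ρ ts ≡ ts
    subV-ground ρ []ᵥ       _ = refl
    subV-ground ρ (t ∷ᵥ ts) g =
      cong₂ _∷ᵥ_ (subT-ground ρ t (++-conicalˡ (varsT t) _ g)) (subV-ground ρ ts (++-conicalʳ (varsT t) _ g))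

  mutual
    subT-cong : ∀ {ρ ρ′} t → (∀ x → x ∈ varsT t → ρ x ≡ ρ′ x) → subT ρ t ≡ subT ρ′ t
    subT-cong (var x)    eq = eq x (here refl)
    subT-cong (fun f ts) eq = cong (fun f) (subV-cong ts eq)

    subV-cong : ∀ {ρ ρ′ k} (ts : Vec Term k) → (∀ x → x ∈ varsV ts → ρ x ≡ ρ′ x) → subV ρ ts ≡ subV ρ′ ts
    subV-cong []ᵥ       eq = refl
    subV-cong (t ∷ᵥ ts) eq =
      cong₂ _∷ᵥ_ (subT-cong t (λ x x∈ → eq x (∈-++⁺ˡ x∈))) (subV-cong ts (λ x x∈ → eq x (∈-++⁺ʳ (varsT t) x∈)))

  subA-cong : ∀ {ρ ρ′} a → (∀ x → x ∈ varsA a → ρ x ≡ ρ′ x) → subA ρ a ≡ subA ρ′ a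
  subA-cong (pred p ts) eq = cong (pred p) (subV-cong ts eq)

  mutual
    subT-∘ : ∀ δ ρ t → subT δ (subT ρ t) ≡ subT (λ x → subT δ (ρ x)) t
    subT-∘ δ ρ (var x)    = refl
    subT-∘ δ ρ (fun f ts) = cong (fun f) (subV-∘ δ ρ ts)

    subV-∘ : ∀ δ ρ {k} (ts : Vec Term k) → subV δ (subV ρ ts) ≡ subV (λ x → subT δ (ρ x)) ts
    subV-∘ δ ρ []ᵥ       = refl
    subV-∘ δ ρ (t ∷ᵥ ts) = cong₂ _∷ᵥ_ (subT-∘ δ ρ t) (subV-∘ δ ρ ts)

  mutual
    ∈-varsT-subT⁺ : ∀ ρ t {x y} → x ∈ varsT t → y ∈ varsT (ρ x) → y ∈ varsT (subT ρ t)
    ∈-varsT-subT⁺ ρ (var x)    (here refl) y∈ = y∈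
    ∈-varsT-subT⁺ ρ (fun f ts) x∈          y∈ = ∈-varsV-subV⁺ ρ ts x∈ y∈

    ∈-varsV-subV⁺ : ∀ ρ {k} (ts : Vec Term k) {x y} → x ∈ varsV ts → y ∈ varsT (ρ x) → y ∈ varsV (subV ρ ts)
    ∈-varsV-subV⁺ ρ (t ∷ᵥ ts) x∈ y∈ with ∈-++⁻ (varsT t) x∈
    ... | inj₁ x∈t  = ∈-++⁺ˡ (∈-varsT-subT⁺ ρ t x∈t y∈)
    ... | inj₂ x∈ts = ∈-++⁺ʳ (varsT (subT ρ t)) (∈-varsV-subV⁺ ρ ts x∈ts y∈)

  mutual
    ∈-varsT-subT⁻ : ∀ ρ t {y} → y ∈ varsT (subT ρ t) → ∃[ x ] (x ∈ varsT t × y ∈ varsT (ρ x))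
    ∈-varsT-subT⁻ ρ (var x)    y∈ = x , here refl , y∈
    ∈-varsT-subT⁻ ρ (fun f ts) y∈ = ∈-varsV-subV⁻ ρ ts y∈

    ∈-varsV-subV⁻ : ∀ ρ {k} (ts : Vec Term k) {y} → y ∈ varsV (subV ρ ts) →
                    ∃[ x ] (x ∈ varsV ts × y ∈ varsT (ρ x))
    ∈-varsV-subV⁻ ρ (t ∷ᵥ ts) y∈ with ∈-++⁻ (varsT (subT ρ t)) y∈
    ... | inj₁ y∈t  = let x , x∈ , y∈x = ∈-varsT-subT⁻ ρ t y∈t in x , ∈-++⁺ˡ x∈ , y∈x
    ... | inj₂ y∈ts = let x , x∈ , y∈x = ∈-varsV-subV⁻ ρ ts y∈ts in x , ∈-++⁺ʳ (varsT t) x∈ , y∈x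

  ∈-varsA-subA⁺ : ∀ ρ a {x y} → x ∈ varsA a → y ∈ varsT (ρ x) → y ∈ varsA (subA ρ a)
  ∈-varsA-subA⁺ ρ (pred p ts) = ∈-varsV-subV⁺ ρ ts

  ∈-varsA-subA⁻ : ∀ ρ a {y} → y ∈ varsA (subA ρ a) → ∃[ x ] (x ∈ varsA a × y ∈ varsT (ρ x))
  ∈-varsA-subA⁻ ρ (pred p ts) = ∈-varsV-subV⁻ ρ ts

  toList-subV : ∀ ρ {k} (ts : Vec Term k) → toList (subV ρ ts) ≡ map (subT ρ) (toList ts)
  toList-subV ρ []ᵥ       = refl
  toList-subV ρ (t ∷ᵥ ts) = cong (subT ρ t ∷_) (toList-subV ρ ts)

  subV-pointwise : ∀ θ ρ (h : Term → Term) {k} (ts : Vec Term k) →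
                  (∀ u → u ∈ toList ts → subT θ u ≡ h (subT ρ u)) → subV θ ts ≡ V.map h (subV ρ ts)
  subV-pointwise θ ρ h []ᵥ       _  = refl
  subV-pointwise θ ρ h (t ∷ᵥ ts) eq =
    cong₂ _∷ᵥ_ (eq t (here refl)) (subV-pointwise θ ρ h ts (λ u u∈ → eq u (there u∈)))

  -- Variable depth

  ground⊎occurs : ∀ t → Ground t ⊎ ∃[ x ] x ∈ varsT t
  ground⊎occurs t = ≡[]⊎∈ (varsT t)

  vdp-fun : ∀ f (ts : Vec Term (fArity f)) {x} → x ∈ varsV ts → vdp (fun f ts) ≡ sucℤ (vdpV ts)
  vdp-fun f ts x∈ with varsV ts
  vdp-fun f ts () | []
  ... | _ ∷ _ = refl

  vdp-ground : ∀ t → Ground t → vdp t ≡ -1ℤ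
  vdp-ground (fun f ts) g rewrite g = refl

  mutual
    -1≤vdp : ∀ t → -1ℤ ≤ℤ vdp t
    -1≤vdp (var x) = ℤ.-≤+
    -1≤vdp (fun f ts) with null (varsV ts)
    ... | true  = ℤ.≤-refl
    ... | false = ℤ.≤-trans (ℤ.i≤suc[i] -1ℤ) (ℤ.suc-mono (-1≤vdpV ts))

    -1≤vdpV : ∀ {k} (ts : Vec Term k) → -1ℤ ≤ℤ vdpV ts
    -1≤vdpV []ᵥ       = ℤ.≤-refl
    -1≤vdpV (t ∷ᵥ ts) = ℤ.≤-trans (-1≤vdp t) (ℤ.i≤i⊔j _ _)

  ground⇒vdp≤0 : ∀ t → Ground t → vdp t ≤ℤ 0ℤ
  ground⇒vdp≤0 t g = subst (_≤ℤ 0ℤ) (sym (vdp-ground t g)) ℤ.-≤+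

  vdp≤vdpV : ∀ {k} (ts : Vec Term k) {u} → u ∈ toList ts → vdp u ≤ℤ vdpV ts
  vdp≤vdpV (t ∷ᵥ ts) (here refl) = ℤ.i≤i⊔j _ _
  vdp≤vdpV (t ∷ᵥ ts) (there u∈)  = ℤ.≤-trans (vdp≤vdpV ts u∈) (ℤ.i≤j⊔i _ _)

  mutual
    0≤vdp : ∀ t {x} → x ∈ varsT t → 0ℤ ≤ℤ vdp t
    0≤vdp (var y)    x∈ = ℤ.≤-refl
    0≤vdp (fun f ts) x∈ rewrite vdp-fun f ts x∈ = ℤ.≤-trans (0≤vdpV ts x∈) (ℤ.i≤suc[i] _)

    0≤vdpV : ∀ {k} (ts : Vec Term k) {x} → x ∈ varsV ts → 0ℤ ≤ℤ vdpV ts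
    0≤vdpV (t ∷ᵥ ts) x∈ with ∈-++⁻ (varsT t) x∈
    ... | inj₁ x∈t  = ℤ.≤-trans (0≤vdp t x∈t) (ℤ.i≤i⊔j _ _)
    ... | inj₂ x∈ts = ℤ.≤-trans (0≤vdpV ts x∈ts) (ℤ.i≤j⊔i _ _)

  vdp≤-1⇒ground : ∀ t → vdp t ≤ℤ -1ℤ → Ground t
  vdp≤-1⇒ground t le with ground⊎occurs t
  ... | inj₁ g        = g
  ... | inj₂ (x , x∈) with ℤ.≤-trans (0≤vdp t x∈) le
  ...   | ()

  0≤vdp⇒occurs : ∀ t → 0ℤ ≤ℤ vdp t → ∃[ x ] x ∈ varsT t
  0≤vdp⇒occurs t le with ground⊎occurs t
  ... | inj₂ occ = occ
  ... | inj₁ g with subst (0ℤ ≤ℤ_) (vdp-ground t g) le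
  ...   | ()

  suc-vdpV-lub : ∀ {k} (ts : Vec Term k) {c} → 0ℤ ≤ℤ c → (∀ u → u ∈ toList ts → sucℤ (vdp u) ≤ℤ c) →
                 sucℤ (vdpV ts) ≤ℤ c
  suc-vdpV-lub []ᵥ       0≤c _  = 0≤c
  suc-vdpV-lub (t ∷ᵥ ts) 0≤c le rewrite ℤ.mono-≤-distrib-⊔ ℤ.suc-mono (vdp t) (vdpV ts) =
    ℤ.⊔-lub (le t (here refl)) (suc-vdpV-lub ts 0≤c (λ u u∈ → le u (there u∈)))

  VarOrGround : Term → Set
  VarOrGround t = (∃[ x ] t ≡ var x) ⊎ Ground t

  vdp≤0⇒varOrGround : ∀ t → vdp t ≤ℤ 0ℤ → VarOrGround t
  vdp≤0⇒varOrGround (var x)    _  = inj₁ (x , refl)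
  vdp≤0⇒varOrGround (fun f ts) le with ground⊎occurs (fun f ts)
  ... | inj₁ g        = inj₂ g
  ... | inj₂ (x , x∈) with ℤ.≤-trans (ℤ.suc-mono (0≤vdpV ts x∈)) (subst (_≤ℤ 0ℤ) (vdp-fun f ts x∈) le)
  ...   | +≤+ ()

  args-varOrGround : ∀ f (ts : Vec Term (fArity f)) → vdp (fun f ts) ≤ℤ 1ℤ →
                     ∀ u → u ∈ toList ts → VarOrGround u
  args-varOrGround f ts le u u∈ with ground⊎occurs u
  ... | inj₁ g        = inj₂ g
  ... | inj₂ (x , x∈) =
    vdp≤0⇒varOrGround u (suc-cancel-≤ (ℤ.≤-trans (ℤ.suc-mono (vdp≤vdpV ts u∈)) 1+vdpV≤1))
    where
    1+vdpV≤1 : sucℤ (vdpV ts) ≤ℤ 1ℤ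
    1+vdpV≤1 = subst (_≤ℤ 1ℤ) (vdp-fun f ts (∈-varsV⁺ ts u∈ x∈)) le

  varOrConstant⇒varOrGround : ∀ t → IsVar t ⊎ IsConstant t → VarOrGround t
  varOrConstant⇒varOrGround (var x)    _              = inj₁ (x , refl)
  varOrConstant⇒varOrGround (fun f ts) (inj₂ nullary) = inj₂ (nullary-ground ts nullary)
    where
    nullary-ground : ∀ {k} (ts : Vec Term k) → k ≡ 0 → varsV ts ≡ []
    nullary-ground []ᵥ refl = refl

  mutual
    vdp-var≤vdp-subT : ∀ ρ t {x} → x ∈ varsT t → vdp (ρ x) ≤ℤ vdp (subT ρ t)
    vdp-var≤vdp-subT ρ (var y)    (here refl) = ℤ.≤-refl
    vdp-var≤vdp-subT ρ (fun f ts) {x} x∈ with ground⊎occurs (ρ x)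
    ... | inj₁ g = ℤ.≤-trans (ℤ.≤-reflexive (vdp-ground (ρ x) g)) (-1≤vdp (subT ρ (fun f ts)))
    ... | inj₂ (y , y∈) rewrite vdp-fun f (subV ρ ts) (∈-varsV-subV⁺ ρ ts x∈ y∈) =
      ℤ.≤-trans (vdp-var≤vdpV-subV ρ ts x∈) (ℤ.i≤suc[i] _)

    vdp-var≤vdpV-subV : ∀ ρ {k} (ts : Vec Term k) {x} → x ∈ varsV ts → vdp (ρ x) ≤ℤ vdpV (subV ρ ts)
    vdp-var≤vdpV-subV ρ (t ∷ᵥ ts) x∈ with ∈-++⁻ (varsT t) x∈
    ... | inj₁ x∈t  = ℤ.≤-trans (vdp-var≤vdp-subT ρ t x∈t) (ℤ.i≤i⊔j _ _)
    ... | inj₂ x∈ts = ℤ.≤-trans (vdp-var≤vdpV-subV ρ ts x∈ts) (ℤ.i≤j⊔i _ _)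

  vdp-var<vdp-subT : ∀ ρ f (ts : Vec Term (fArity f)) {x y} → x ∈ varsV ts → y ∈ varsT (ρ x) →
                     sucℤ (vdp (ρ x)) ≤ℤ vdp (subT ρ (fun f ts))
  vdp-var<vdp-subT ρ f ts x∈ y∈ rewrite vdp-fun f (subV ρ ts) (∈-varsV-subV⁺ ρ ts x∈ y∈) =
    ℤ.suc-mono (vdp-var≤vdpV-subV ρ ts x∈)

  mutual
    vdp-subT≤vdp : ∀ ρ t → (∀ x → x ∈ varsT t → vdp (ρ x) ≤ℤ 0ℤ) → vdp (subT ρ t) ≤ℤ vdp t
    vdp-subT≤vdp ρ (var x)    shallow = shallow x (here refl)
    vdp-subT≤vdp ρ (fun f ts) shallow with ground⊎occurs (fun f ts)
    ... | inj₁ g rewrite subV-ground ρ ts g = ℤ.≤-refl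
    ... | inj₂ (x , x∈) with ground⊎occurs (subT ρ (fun f ts))
    ...   | inj₁ g rewrite vdp-ground (subT ρ (fun f ts)) g = -1≤vdp (fun f ts)
    ...   | inj₂ (y , y∈) rewrite vdp-fun f ts x∈ | vdp-fun f (subV ρ ts) y∈ =
      ℤ.suc-mono (vdpV-subV≤vdpV ρ ts shallow)

    vdpV-subV≤vdpV : ∀ ρ {k} (ts : Vec Term k) → (∀ x → x ∈ varsV ts → vdp (ρ x) ≤ℤ 0ℤ) →
                     vdpV (subV ρ ts) ≤ℤ vdpV ts
    vdpV-subV≤vdpV ρ []ᵥ       _       = ℤ.≤-refl
    vdpV-subV≤vdpV ρ (t ∷ᵥ ts) shallow =
      ℤ.⊔-mono-≤ (vdp-subT≤vdp ρ t (λ x x∈ → shallow x (∈-++⁺ˡ x∈)))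
                 (vdpV-subV≤vdpV ρ ts (λ x x∈ → shallow x (∈-++⁺ʳ (varsT t) x∈)))

  vdp-subT-shallow≤ : ∀ ρ f (ts : Vec Term (fArity f)) g (ss : Vec Term (fArity g)) →
                      (∀ u → u ∈ toList ts → VarOrGround u) → (∀ x → x ∈ varsV ts → x ∈ varsV ss) →
                      ∀ {y} → y ∈ varsT (subT ρ (fun f ts)) →
                      vdp (subT ρ (fun f ts)) ≤ℤ vdp (subT ρ (fun g ss))
  vdp-subT-shallow≤ ρ f ts g ss shallow ts⊆ss y∈ with ∈-varsV-subV⁻ ρ ts y∈
  ... | x , x∈ , y∈x rewrite vdp-fun f (subV ρ ts) y∈ = suc-vdpV-lub (subV ρ ts) 0≤rhs arg<rhs
    where
    0≤rhs : 0ℤ ≤ℤ vdp (subT ρ (fun g ss))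
    0≤rhs = 0≤vdp (subT ρ (fun g ss)) (∈-varsV-subV⁺ ρ ss (ts⊆ss x x∈) y∈x)
    arg<rhs : ∀ u → u ∈ toList (subV ρ ts) → sucℤ (vdp u) ≤ℤ vdp (subT ρ (fun g ss))
    arg<rhs u u∈ with ∈-map⁻ (subT ρ) (subst (u ∈_) (toList-subV ρ ts) u∈)
    ... | t , t∈ , refl with shallow t t∈
    ...   | inj₂ g rewrite subT-ground ρ t g | vdp-ground t g = 0≤rhs
    ...   | inj₁ (x , refl) with ground⊎occurs (ρ x)
    ...     | inj₁ g rewrite vdp-ground (ρ x) g = 0≤rhs
    ...     | inj₂ (_ , z∈) = vdp-var<vdp-subT ρ g ss (ts⊆ss x (∈-varsV⁺ ts t∈ (here refl))) z∈

  predOf : Atom → PSym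
  predOf (pred p _) = p

  ArgPair : Atom → Atom → Term → Term → Set
  ArgPair a b t u = (t , u) ∈ zip (argsA a) (argsA b)

  argPair⁻ : ∀ a b {t u} → ArgPair a b t u → t ∈ argsA a × u ∈ argsA b
  argPair⁻ a b = ∈-zip⁻ (argsA a) (argsA b)

  unifier-argPair : ∀ ρ a b {t u} → subA ρ a ≡ subA ρ b → ArgPair a b t u → subT ρ t ≡ subT ρ u
  unifier-argPair ρ (pred p ts) (pred q us) eq =
    map-≡⇒zip-≡ (subT ρ) (toList ts) (toList us)
      (trans (sym (toList-subV ρ ts)) (trans (cong argsA eq) (toList-subV ρ us)))

  unifier-partnerˡ : ∀ ρ a b {t} → subA ρ a ≡ subA ρ b → t ∈ argsA a → ∃[ u ] ArgPair a b t u
  unifier-partnerˡ ρ (pred p ts) (pred q us) eq with cong predOf eq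
  ... | refl = ∈-zip-partnerˡ ts us

  unifier-partnerʳ : ∀ ρ a b {u} → subA ρ a ≡ subA ρ b → u ∈ argsA b → ∃[ t ] ArgPair a b t u
  unifier-partnerʳ ρ (pred p ts) (pred q us) eq with cong predOf eq
  ... | refl = ∈-zip-partnerʳ ts us

  subV-pairwise : ∀ θ {k} (ts us : Vec Term k) →
                  (∀ {t u} → (t , u) ∈ zip (toList ts) (toList us) → subT θ t ≡ subT θ u) →
                  subV θ ts ≡ subV θ us
  subV-pairwise θ []ᵥ       []ᵥ       _  = refl
  subV-pairwise θ (t ∷ᵥ ts) (u ∷ᵥ us) eq =
    cong₂ _∷ᵥ_ (eq (here refl)) (subV-pairwise θ ts us (λ tu∈ → eq (there tu∈)))

  argPairs-unifier : ∀ ρ θ a b → subA ρ a ≡ subA ρ b →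
                     (∀ {t u} → ArgPair a b t u → subT θ t ≡ subT θ u) → subA θ a ≡ subA θ b
  argPairs-unifier ρ θ (pred p ts) (pred q us) eq pairwise with cong predOf eq
  ... | refl = cong (pred p) (subV-pairwise θ ts us pairwise)

  ∈-termsC⁻ : ∀ c {t} → t ∈ termsC c → ∃[ l ] (l ∈ c × t ∈ termsL l)
  ∈-termsC⁻ c = ∈-concatMap-elim

  ∈-termsC⁺ : ∀ c {t l} → l ∈ c → t ∈ termsL l → t ∈ termsC c
  ∈-termsC⁺ c = ∈-concatMap-intro

  termsL-subL : ∀ ρ l → termsL (subL ρ l) ≡ map (subT ρ) (termsL l)
  termsL-subL ρ (pos (pred p ts)) = toList-subV ρ ts
  termsL-subL ρ (neg (pred p ts)) = toList-subV ρ ts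

  ∈-termsC-subC⁻ : ∀ ρ c {t} → t ∈ termsC (subC ρ c) → ∃[ t′ ] (t′ ∈ termsC c × t ≡ subT ρ t′)
  ∈-termsC-subC⁻ ρ c t∈ with ∈-termsC⁻ (subC ρ c) t∈
  ... | _ , l∈ , t∈l with ∈-map⁻ (subL ρ) l∈
  ...   | l , l∈c , refl with ∈-map⁻ (subT ρ) (subst (_ ∈_) (termsL-subL ρ l) t∈l)
  ...     | t′ , t′∈ , refl = t′ , ∈-termsC⁺ c l∈c t′∈ , refl

  maxVdp : List Term → ℤ
  maxVdp ts = foldr _⊔_ -1ℤ (map vdp ts)

  vdp≤maxVdp : ∀ ts {t} → t ∈ ts → vdp t ≤ℤ maxVdp ts
  vdp≤maxVdp (t ∷ ts) (here refl) = ℤ.i≤i⊔j _ _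
  vdp≤maxVdp (_ ∷ ts) (there t∈)  = ℤ.≤-trans (vdp≤maxVdp ts t∈) (ℤ.i≤j⊔i _ _)

  maxVdp-lub : ∀ ts {m} → -1ℤ ≤ℤ m → (∀ t → t ∈ ts → vdp t ≤ℤ m) → maxVdp ts ≤ℤ m
  maxVdp-lub []       -1≤m _  = -1≤m
  maxVdp-lub (t ∷ ts) -1≤m le = ℤ.⊔-lub (le t (here refl)) (maxVdp-lub ts -1≤m (λ u u∈ → le u (there u∈)))

  -1≤maxVdp : ∀ ts → -1ℤ ≤ℤ maxVdp ts
  -1≤maxVdp []       = ℤ.≤-refl
  -1≤maxVdp (t ∷ ts) = ℤ.≤-trans (-1≤maxVdp ts) (ℤ.i≤j⊔i _ _)

  data CoveredShape (V : List Var) : Term → Set where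
    ground   : ∀ {t} → Ground t → CoveredShape V t
    isVar    : ∀ x → CoveredShape V (var x)
    covering : ∀ f ts {x} → x ∈ varsV ts → SameVars (varsV ts) V → CoveredShape V (fun f ts)

  coveredShape : ∀ V t → CoveredIn V t → CoveredShape V t
  coveredShape V t (inj₁ g)                = ground g
  coveredShape V (var x) (inj₂ _)          = isVar x
  coveredShape V (fun f ts) (inj₂ (inj₂ (_ , sameVars))) with ground⊎occurs (fun f ts)
  ... | inj₁ g       = ground g
  ... | inj₂ (_ , x∈) = covering f ts x∈ sameVars

  -- Most general unifiers

  mgu-var : ∀ {n} {P : Fin n → Set} {A B : Fin n → Atom} {σ θ} → MGUOn P A B σ → UnifiesOn P A B θ →
            ∀ x {y} → θ x ≡ var y → ∃[ z ] σ x ≡ var z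
  mgu-var {σ = σ} (_ , mostGeneral) θ-unifies x θx≡var with σ x | proj₂ (mostGeneral _ θ-unifies) x
  ... | var z    | _ = z , refl
  ... | fun f ts | θx≡ with trans (sym θx≡) θx≡var
  ...   | ()

  _[_↦var] : Subst → Var → Subst
  (ρ [ v ↦var]) x with x ≟ℕ v
  ... | yes _ = var v
  ... | no  _ = ρ x

  unifier-[↦var] : ∀ {n} {P : Fin n → Set} {A B : Fin n → Atom} {ρ} v → UnifiesOn P A B ρ →
                   (∀ i → P i → v ∉ varsA (A i) × v ∉ varsA (B i)) → UnifiesOn P A B (ρ [ v ↦var])
  unifier-[↦var] {A = A} {B} {ρ} v unifies fresh i Pi = begin
    subA (ρ [ v ↦var]) (A i) ≡⟨ subA-cong (A i) (λ x x∈ → unchanged x (λ { refl → proj₁ (fresh i Pi) x∈ })) ⟩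
    subA ρ (A i)             ≡⟨ unifies i Pi ⟩
    subA ρ (B i)             ≡⟨ subA-cong (B i) (λ x x∈ → unchanged x (λ { refl → proj₂ (fresh i Pi) x∈ })) ⟨
    subA (ρ [ v ↦var]) (B i) ∎
    where
    open ≡-Reasoning
    unchanged : ∀ x → x ≢ v → (ρ [ v ↦var]) x ≡ ρ x
    unchanged x x≢v with x ≟ℕ v
    ... | yes x≡v = ⊥-elim (x≢v x≡v)
    ... | no  _   = refl

  mgu-fresh-var : ∀ {n} {P : Fin n → Set} {A B : Fin n → Atom} {σ} v → MGUOn P A B σ →
                  (∀ i → P i → v ∉ varsA (A i) × v ∉ varsA (B i)) → ∃[ z ] σ v ≡ var z
  mgu-fresh-var v mgu fresh = mgu-var mgu (unifier-[↦var] v (proj₁ mgu) fresh) v v↦v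
    where
    v↦v : (_ [ v ↦var]) v ≡ var v
    v↦v with v ≟ℕ v
    ... | yes _   = refl
    ... | no  v≢v = ⊥-elim (v≢v refl)

  collapse : Term → Term
  collapse u with ground⊎occurs u
  ... | inj₁ _ = u
  ... | inj₂ _ = var 0

  collapse-ground : ∀ u → Ground u → collapse u ≡ u
  collapse-ground u g with ground⊎occurs u
  ... | inj₁ _       = refl
  ... | inj₂ (_ , x∈) = ⊥-elim (∉-≡[] g x∈)

  collapse-occurs : ∀ u {x} → x ∈ varsT u → collapse u ≡ var 0
  collapse-occurs u x∈ with ground⊎occurs u
  ... | inj₁ g = ⊥-elim (∉-≡[] g x∈)
  ... | inj₂ _ = refl

  collapseArgs : Term → Term
  collapseArgs (var x)    = var x
  collapseArgs (fun f us) = fun f (V.map collapse us)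

  module DepthCut (d : ℤ) (δ : Subst) where

    cut : Term → Term
    cut u with d ℤ.≤? vdp (subT δ u)
    ... | yes _ = collapseArgs u
    ... | no  _ = collapse u

    cut-deep : ∀ u → d ≤ℤ vdp (subT δ u) → cut u ≡ collapseArgs u
    cut-deep u deep with d ℤ.≤? vdp (subT δ u)
    ... | yes _       = refl
    ... | no  shallow = ⊥-elim (shallow deep)

    cut-shallow : ∀ u → ¬ d ≤ℤ vdp (subT δ u) → cut u ≡ collapse u
    cut-shallow u shallow with d ℤ.≤? vdp (subT δ u)
    ... | yes deep = ⊥-elim (shallow deep)
    ... | no  _    = refl

  module Inference
      (n : ℕ) (A B : Fin n → Atom) (D : Clause) (Ds : Fin n → Clause) (σ₀ : Subst)
      (qp : QueryPair A B σ₀) (simpleDs : ∀ i → SimpleC (Ds i)) (query : QueryClause (mainPremise A D))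
      (lgc : ∀ i → LGC (sidePremise B Ds i)) (T : Fin n → Bool)
      (selected⇔top : ∀ i → (T i ≡ true) ⇔ ContainsTopVar A σ₀ i)
      (σ : Subst) (mgu : MGUOn (λ i → T i ≡ true) A B σ) where
    open QueryPair qp

    Selected : Fin n → Set
    Selected i = T i ≡ true

    Prem : Clause
    Prem = premises A B D Ds T

    M : ℤ
    M = vdpC Prem

    unifies₀ : ∀ i → subA σ₀ (A i) ≡ subA σ₀ (B i)
    unifies₀ i = proj₁ mgu₀ i tt

    unifies : ∀ i → Selected i → subA σ (A i) ≡ subA σ (B i)
    unifies = proj₁ mgu

    ∈-varsAs⁺ : ∀ i {x} → x ∈ varsA (A i) → x ∈ varsAs A
    ∈-varsAs⁺ i = ∈-concatMap-intro (∈-allFin i)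

    negA∈main : ∀ i → neg (A i) ∈ mainPremise A D
    negA∈main i = ∈-++⁺ˡ (∈-map⁺ (λ j → neg (A j)) (∈-allFin i))

    main-term∈Prem : ∀ {t} → t ∈ termsC (mainPremise A D) → t ∈ termsC Prem
    main-term∈Prem t∈ = let l , l∈ , t∈l = ∈-termsC⁻ (mainPremise A D) t∈ in ∈-termsC⁺ Prem (∈-++⁺ˡ l∈) t∈l

    side-term∈Prem : ∀ i → Selected i → ∀ {t} → t ∈ termsC (sidePremise B Ds i) → t ∈ termsC Prem
    side-term∈Prem i sel t∈ with ∈-termsC⁻ (sidePremise B Ds i) t∈
    ... | l , l∈ , t∈l =
      ∈-termsC⁺ Prem (∈-++⁺ʳ (mainPremise A D) (∈-concatMap-intro (∈-allFin i) (∈-if-true⁺ sel l∈))) t∈l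

    A-arg∈main : ∀ i {t} → t ∈ argsA (A i) → t ∈ termsC (mainPremise A D)
    A-arg∈main i = ∈-termsC⁺ (mainPremise A D) (negA∈main i)

    main-varOrGround : ∀ {t} → t ∈ termsC (mainPremise A D) → VarOrGround t
    main-varOrGround {t} t∈ = varOrConstant⇒varOrGround t (All.lookup (proj₂ query) t∈)

    var∈A-arg : ∀ i {x} → x ∈ varsA (A i) → var x ∈ argsA (A i)
    var∈A-arg i x∈ with ∈-varsA⁻ (A i) x∈
    ... | t , t∈ , x∈t with main-varOrGround (A-arg∈main i t∈)
    ...   | inj₁ (_ , refl) with x∈t
    ...     | here refl = t∈
    var∈A-arg i x∈ | t , t∈ , x∈t | inj₂ g = ⊥-elim (∉-≡[] g x∈t)

    B-arg-shape : ∀ i {u} → u ∈ argsA (B i) → CoveredShape (varsA (B i)) u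
    B-arg-shape i {u} u∈ = coveredShape (varsA (B i)) u (All.lookup (B-wc i) u∈)

    Small : Var → Set
    Small v = vdp (σ v) ≤ℤ 0ℤ

    Bounded : Term → Set
    Bounded u = vdp u ≤ℤ 1ℤ × vdp u ≤ℤ M

    small⇒bounded : ∀ {v} → var v ∈ termsC Prem → Small v → Bounded (σ v)
    small⇒bounded v∈ small = ℤ.≤-trans small 0≤1 , ℤ.≤-trans small (vdp≤maxVdp (termsC Prem) v∈)

    EqVars : List Var
    EqVars = concatMap (λ i → if T i then varsA (A i) ++ varsA (B i) else []) (allFin n)

    ∈-EqVars⁻ : ∀ {v} → v ∈ EqVars → ∃[ i ] (Selected i × (v ∈ varsA (A i) ⊎ v ∈ varsA (B i)))
    ∈-EqVars⁻ v∈ with ∈-concatMap-elim {xs = allFin n} v∈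
    ... | i , _ , v∈i = let sel , v∈AB = ∈-if-true⁻ (T i) v∈i in i , sel , ∈-++⁻ (varsA (A i)) v∈AB

    ∉-EqVars : ∀ {v} → v ∉ EqVars → ∀ i → Selected i → v ∉ varsA (A i) × v ∉ varsA (B i)
    ∉-EqVars v∉ i sel =
      (λ v∈A → v∉ (∈-EqVars⁺ (∈-++⁺ˡ v∈A))) , (λ v∈B → v∉ (∈-EqVars⁺ (∈-++⁺ʳ (varsA (A i)) v∈B)))
      where
      ∈-EqVars⁺ : ∀ {v} → v ∈ varsA (A i) ++ varsA (B i) → v ∈ EqVars
      ∈-EqVars⁺ v∈ = ∈-concatMap-intro (∈-allFin i) (∈-if-true⁺ sel v∈)

    outside-small : ∀ v → v ∉ EqVars → Small v
    outside-small v v∉ with mgu-fresh-var v mgu (∉-EqVars v∉)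
    ... | _ , σv≡var rewrite σv≡var = ℤ.≤-refl

    module GroundCase (ground₀ : ∀ y → y ∈ varsAs A → Ground (σ₀ y)) where

      all-selected : ∀ j → Selected j
      all-selected j with ≡[]⊎∈ (varsA (A j))
      ... | inj₁ g        = ⊥-elim (A-nonground j g)
      ... | inj₂ (y , y∈) = Equivalence.from (selected⇔top j) (y , y∈ , ∈-varsAs⁺ j y∈ , y-top)
        where
        y-top : ∀ z → z ∈ varsAs A → vdp (σ₀ z) ≤ℤ vdp (σ₀ y)
        y-top z z∈ = ℤ.≤-trans (ℤ.≤-reflexive (vdp-ground (σ₀ z) (ground₀ z z∈))) (-1≤vdp (σ₀ y))

      B-ground₀ : ∀ j {z} → z ∈ varsA (B j) → Ground (σ₀ z)
      B-ground₀ j {z} z∈ with ground⊎occurs (σ₀ z)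
      ... | inj₁ g        = g
      ... | inj₂ (w , w∈)
          with ∈-varsA-subA⁻ σ₀ (A j) (subst (λ a → w ∈ varsA a) (sym (unifies₀ j)) (∈-varsA-subA⁺ σ₀ (B j) z∈ w∈))
      ...   | y , y∈ , w∈y = ⊥-elim (∉-≡[] (ground₀ y (∈-varsAs⁺ j y∈)) w∈y)

      small : ∀ v → Small v
      small v with v ∈? EqVars
      ... | no  v∉ = outside-small v v∉
      ... | yes v∈ with ∈-EqVars⁻ v∈
      ...   | j , _ , v∈AB = subst (_≤ℤ 0ℤ) (cong vdp (sym σv≡σ₀v)) (ground⇒vdp≤0 (σ₀ v) σ₀v-ground)
        where
        σ₀v-ground : Ground (σ₀ v)
        σ₀v-ground = [ (λ v∈A → ground₀ v (∈-varsAs⁺ j v∈A)) , B-ground₀ j ]′ v∈AB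
        σv≡σ₀v : σ v ≡ σ₀ v
        σv≡σ₀v with proj₂ mgu₀ σ (λ i _ → unifies i (all-selected i))
        ... | δ₁ , σ≡δ₁σ₀ = trans (σ≡δ₁σ₀ v) (subT-ground δ₁ (σ₀ v) σ₀v-ground)

    record CoveringArg (j : Fin n) : Set where
      constructor coveringArg
      field
        f        : FSym
        ts       : Vec Term (fArity f)
        ∈args    : fun f ts ∈ argsA (B j)
        sameVars : SameVars (varsV ts) (varsA (B j))

      term : Term
      term = fun f ts

    coveringArg-of-var : ∀ j {z} → z ∈ varsA (B j) → CoveringArg j
    coveringArg-of-var j z∈ with B-shape j
    ... | inj₂ B-ground = ⊥-elim (∉-≡[] B-ground z∈)
    ... | inj₁ nonground-compound with find nonground-compound
    ...   | s , s∈ , compound , nonground with B-arg-shape j s∈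
    ...     | ground g             = ⊥-elim (nonground g)
    ...     | isVar _              = ⊥-elim compound
    ...     | covering g ss _ same = coveringArg g ss s∈ same

    nonground-partner : ∀ j {s} → s ∈ argsA (B j) → ∀ {w} → w ∈ varsT (subT σ₀ s) →
                        ∃[ y ] (y ∈ varsAs A × σ₀ y ≡ subT σ₀ s)
    nonground-partner j s∈ w∈ with unifier-partnerʳ σ₀ (A j) (B j) (unifies₀ j) s∈
    ... | a , pair with main-varOrGround (A-arg∈main j (proj₁ (argPair⁻ (A j) (B j) pair)))
    ...   | inj₁ (y , refl) = y , ∈-varsAs⁺ j (∈-varsA⁺ (A j) (proj₁ (argPair⁻ (A j) (B j) pair)) (here refl))
                                , unifier-argPair σ₀ (A j) (B j) (unifies₀ j) pair
    ...   | inj₂ ground-a = ⊥-elim (∉-≡[] ground-a (subst (λ t → _ ∈ varsT t) σ₀s≡a w∈))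
      where
      σ₀s≡a : _ ≡ a
      σ₀s≡a = trans (sym (unifier-argPair σ₀ (A j) (B j) (unifies₀ j) pair)) (subT-ground σ₀ a ground-a)

    side-shape : ∀ j {u} → u ∈ termsC (sidePremise B Ds j) → CoveredShape (varsC (sidePremise B Ds j)) u
    side-shape j {u} u∈ = coveredShape _ u (All.lookup (proj₁ (proj₂ (lgc j))) u∈)

    record TopDepth : Set where
      field
        d          : ℤ
        0≤d        : 0ℤ ≤ℤ d
        d-max      : ∀ y → y ∈ varsAs A → vdp (σ₀ y) ≤ℤ d
        d-attained : ∀ j → Selected j → ∃[ x ] (x ∈ varsA (A j) × vdp (σ₀ x) ≡ d)

    module NonGroundCase (top : TopDepth) where
      open TopDepth top

      B-var-below : ∀ j {z} → z ∈ varsA (B j) → sucℤ (vdp (σ₀ z)) ≤ℤ d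
      B-var-below j {z} z∈ with ground⊎occurs (σ₀ z)
      ... | inj₁ g rewrite vdp-ground (σ₀ z) g = 0≤d
      ... | inj₂ (w , w∈) with coveringArg-of-var j z∈
      ...   | coveringArg g ss ∈args sameVars
          with nonground-partner j ∈args (∈-varsT-subT⁺ σ₀ (fun g ss) (proj₂ (sameVars z) z∈) w∈)
      ...     | y , y∈ , σ₀y≡σ₀s = begin
        sucℤ (vdp (σ₀ z))        ≤⟨ vdp-var<vdp-subT σ₀ g ss (proj₂ (sameVars z) z∈) w∈ ⟩
        vdp (subT σ₀ (fun g ss)) ≡⟨ cong vdp σ₀y≡σ₀s ⟨
        vdp (σ₀ y)               ≤⟨ d-max y y∈ ⟩
        d                        ∎
        where open ℤ.≤-Reasoning

      depth-d⇒occurs : ∀ t → vdp t ≡ d → ∃[ y ] y ∈ varsT t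
      depth-d⇒occurs t depth = 0≤vdp⇒occurs t (subst (0ℤ ≤ℤ_) (sym depth) 0≤d)

      TopArgument : Fin n → Set
      TopArgument j = Σ[ c ∈ CoveringArg j ] vdp (subT σ₀ (CoveringArg.term c)) ≡ d

      topArgument : ∀ j → Selected j → TopArgument j
      topArgument j sel with d-attained j sel
      ... | x , x∈ , σ₀x-depth with unifier-partnerˡ σ₀ (A j) (B j) (unifies₀ j) (var∈A-arg j x∈)
      ...   | u , pair with B-arg-shape j (proj₂ (argPair⁻ (A j) (B j) pair))
      ...     | ground g = ⊥-elim (0≰-1 (subst (0ℤ ≤ℤ_) d≡-1 0≤d))
        where
        d≡-1 : d ≡ -1ℤ
        d≡-1 = trans (sym σ₀x-depth)
                 (trans (cong vdp (unifier-argPair σ₀ (A j) (B j) (unifies₀ j) pair))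
                   (trans (cong vdp (subT-ground σ₀ u g)) (vdp-ground u g)))
      ...     | isVar z = ⊥-elim (suc[i]≰i (subst (λ e → sucℤ e ≤ℤ d) σ₀z-depth (B-var-below j z∈)))
        where
        z∈ : z ∈ varsA (B j)
        z∈ = ∈-varsA⁺ (B j) (proj₂ (argPair⁻ (A j) (B j) pair)) (here refl)
        σ₀z-depth : vdp (σ₀ z) ≡ d
        σ₀z-depth = trans (cong vdp (sym (unifier-argPair σ₀ (A j) (B j) (unifies₀ j) pair))) σ₀x-depth
      ...     | covering f ts _ sameVars =
        coveringArg f ts (proj₂ (argPair⁻ (A j) (B j) pair)) sameVars ,
        trans (cong vdp (sym (unifier-argPair σ₀ (A j) (B j) (unifies₀ j) pair))) σ₀x-depth

      B-covering-above : ∀ j → Selected j → ∀ {g ss} → fun g ss ∈ argsA (B j) →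
                         SameVars (varsV ss) (varsA (B j)) → d ≤ℤ vdp (subT σ₀ (fun g ss))
      B-covering-above j sel {g} {ss} ∈args-s sameVars-s with topArgument j sel
      ... | coveringArg f ts ∈args sameVars , depth = begin
        d                        ≡⟨ depth ⟨
        vdp (subT σ₀ (fun f ts)) ≤⟨ vdp-subT-shallow≤ σ₀ f ts g ss shallow ts⊆ss (proj₂ nonground) ⟩
        vdp (subT σ₀ (fun g ss)) ∎
        where
        open ℤ.≤-Reasoning
        shallow : ∀ u → u ∈ toList ts → VarOrGround u
        shallow = args-varOrGround f ts (All.lookup (B-simple j) ∈args)
        ts⊆ss : ∀ x → x ∈ varsV ts → x ∈ varsV ss
        ts⊆ss x x∈ = proj₂ (sameVars-s x) (proj₁ (sameVars x) x∈)
        nonground : ∃[ y ] y ∈ varsT (subT σ₀ (fun f ts))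
        nonground = depth-d⇒occurs (subT σ₀ (fun f ts)) depth

      σ₀-instance : ∃[ δ ] (∀ x → σ₀ x ≡ subT δ (σ x))
      σ₀-instance = proj₂ mgu σ₀ (λ j _ → unifies₀ j)

      δ₀ : Subst
      δ₀ = proj₁ σ₀-instance

      σ₀≡δ₀σ : ∀ t → subT σ₀ t ≡ subT δ₀ (subT σ t)
      σ₀≡δ₀σ t = trans (subT-cong t (λ x _ → proj₂ σ₀-instance x)) (sym (subT-∘ δ₀ σ t))

      open DepthCut d δ₀

      θ : Subst
      θ x = cut (σ x)

      cut-ground : ∀ u → Ground u → cut u ≡ u
      cut-ground u g = trans (cut-shallow u below) (collapse-ground u g)
        where
        below : ¬ d ≤ℤ vdp (subT δ₀ u)
        below d≤ = 0≰-1 (ℤ.≤-trans 0≤d (subst (d ≤ℤ_) δ₀u-depth d≤))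
          where
          δ₀u-depth : vdp (subT δ₀ u) ≡ -1ℤ
          δ₀u-depth = trans (cong vdp (subT-ground δ₀ u g)) (vdp-ground u g)

      θ-ground : ∀ u → Ground u → subT θ u ≡ cut (subT σ u)
      θ-ground u g = trans (subT-ground θ u g) (sym (trans (cong cut (subT-ground σ u g)) (cut-ground u g)))

      θ-B-var : ∀ j {z} → z ∈ varsA (B j) → θ z ≡ collapse (σ z)
      θ-B-var j {z} z∈ = cut-shallow (σ z) λ d≤ →
        suc[i]≰i (ℤ.≤-trans (B-var-below j z∈) (subst (d ≤ℤ_) (cong vdp (sym (σ₀≡δ₀σ (var z)))) d≤))

      θ-B-arg : ∀ j → Selected j → ∀ {r} → r ∈ argsA (B j) → subT θ r ≡ cut (subT σ r)
      θ-B-arg j sel {r} r∈ with B-arg-shape j r∈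
      ... | ground g = θ-ground r g
      ... | isVar z  = refl
      ... | covering g ss _ sameVars = sym (begin
        cut (subT σ (fun g ss))          ≡⟨ cut-deep (subT σ (fun g ss)) deep ⟩
        fun g (V.map collapse (subV σ ss)) ≡⟨ cong (fun g) (subV-pointwise θ σ collapse ss θ-arg) ⟨
        subT θ (fun g ss)                ∎)
        where
        open ≡-Reasoning
        deep : d ≤ℤ vdp (subT δ₀ (subT σ (fun g ss)))
        deep = subst (d ≤ℤ_) (cong vdp (σ₀≡δ₀σ (fun g ss))) (B-covering-above j sel r∈ sameVars)
        θ-arg : ∀ u → u ∈ toList ss → subT θ u ≡ collapse (subT σ u)
        θ-arg u u∈ with args-varOrGround g ss (All.lookup (B-simple j) r∈) u u∈
        ... | inj₁ (z , refl) = θ-B-var j (proj₁ (sameVars z) (∈-varsV⁺ ss u∈ (here refl)))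
        ... | inj₂ g′ =
          trans (subT-ground θ u g′) (sym (trans (cong collapse (subT-ground σ u g′)) (collapse-ground u g′)))

      θ-A-arg : ∀ j {r} → r ∈ argsA (A j) → subT θ r ≡ cut (subT σ r)
      θ-A-arg j {r} r∈ with main-varOrGround (A-arg∈main j r∈)
      ... | inj₁ (_ , refl) = refl
      ... | inj₂ g          = θ-ground r g

      θ-unifies : UnifiesOn Selected A B θ
      θ-unifies j sel = argPairs-unifier σ₀ θ (A j) (B j) (unifies₀ j) λ {t} {u} pair →
        let t∈ , u∈ = argPair⁻ (A j) (B j) pair in begin
        subT θ t        ≡⟨ θ-A-arg j t∈ ⟩
        cut (subT σ t)  ≡⟨ cong cut (unifier-argPair σ (A j) (B j) (unifies j sel) pair) ⟩
        cut (subT σ u)  ≡⟨ θ-B-arg j sel u∈ ⟨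
        subT θ u        ∎
        where open ≡-Reasoning

      B-small : ∀ j → Selected j → ∀ {z} → z ∈ varsA (B j) → Small z
      B-small j sel {z} z∈ with ground⊎occurs (σ z)
      ... | inj₁ g = ground⇒vdp≤0 (σ z) g
      ... | inj₂ (_ , y∈) with mgu-var mgu θ-unifies z (trans (θ-B-var j z∈) (collapse-occurs (σ z) y∈))
      ...   | _ , σz≡var rewrite σz≡var = ℤ.≤-refl

      B-partner-bounded : ∀ j → Selected j → ∀ {y u} → var y ∈ termsC Prem → u ∈ argsA (B j) →
                          σ y ≡ subT σ u → Bounded (σ y)
      B-partner-bounded j sel {y} {u} y∈Prem u∈ σy≡σu with B-arg-shape j u∈
      ... | ground g = small⇒bounded y∈Prem (subst (_≤ℤ 0ℤ) (cong vdp (sym σy≡u)) (ground⇒vdp≤0 u g))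
        where
        σy≡u : σ y ≡ u
        σy≡u = trans σy≡σu (subT-ground σ u g)
      ... | isVar z =
        small⇒bounded y∈Prem
          (subst (_≤ℤ 0ℤ) (cong vdp (sym σy≡σu)) (B-small j sel (∈-varsA⁺ (B j) u∈ (here refl))))
      ... | covering g ss _ sameVars =
        ℤ.≤-trans σy≤u (All.lookup (B-simple j) u∈) ,
        ℤ.≤-trans σy≤u (vdp≤maxVdp (termsC Prem) (side-term∈Prem j sel (∈-++⁺ˡ u∈)))
        where
        σy≤u : vdp (σ y) ≤ℤ vdp (fun g ss)
        σy≤u = subst (_≤ℤ vdp (fun g ss)) (cong vdp (sym σy≡σu))
                 (vdp-subT≤vdp σ (fun g ss) (λ x x∈ → B-small j sel (proj₁ (sameVars x) x∈)))

      A-bounded : ∀ j → Selected j → ∀ {y} → y ∈ varsA (A j) → Bounded (σ y)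
      A-bounded j sel {y} y∈ =
        let u , pair = unifier-partnerˡ σ (A j) (B j) (unifies j sel) (var∈A-arg j y∈)
        in B-partner-bounded j sel (main-term∈Prem (A-arg∈main j (var∈A-arg j y∈)))
             (proj₂ (argPair⁻ (A j) (B j) pair)) (unifier-argPair σ (A j) (B j) (unifies j sel) pair)

      side-small : ∀ j → Selected j → ∀ {g ss} → fun g ss ∈ termsC (Ds j) → ∀ {v} → v ∈ varsV ss → Small v
      side-small j sel t∈ {v} v∈ with topArgument j sel
      ... | coveringArg f ts ∈args sameVars , depth
          with side-shape j (∈-++⁺ʳ (argsA (B j)) t∈) | side-shape j (∈-++⁺ˡ ∈args)
      ...   | ground g              | _               = ⊥-elim (∉-≡[] g v∈)
      ...   | covering _ _ _ _      | ground g        = ⊥-elim (∉-≡[] g (proj₂ top-occurs))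
        where
        top-occurs : ∃[ y ] y ∈ varsV ts
        top-occurs = let _ , w∈ = depth-d⇒occurs (subT σ₀ (fun f ts)) depth
                         y , y∈ , _ = ∈-varsV-subV⁻ σ₀ ts w∈
                     in y , y∈
      ...   | covering _ _ _ same-t | covering _ _ _ same-top =
        B-small j sel (proj₁ (sameVars v) (proj₂ (same-top v) (proj₁ (same-t v) v∈)))

    groundOrTop : ∀ j → Selected j → (∀ y → y ∈ varsAs A → Ground (σ₀ y)) ⊎ TopDepth
    groundOrTop j sel with Equivalence.to (selected⇔top j) sel
    ... | x , _ , x∈As , x-top with ground⊎occurs (σ₀ x)
    ...   | inj₁ g =
      inj₁ (λ y y∈ → vdp≤-1⇒ground (σ₀ y) (ℤ.≤-trans (x-top y y∈) (ℤ.≤-reflexive (vdp-ground (σ₀ x) g))))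
    ...   | inj₂ (_ , w∈) = inj₂ record
      { d = vdp (σ₀ x) ; 0≤d = 0≤vdp (σ₀ x) w∈ ; d-max = x-top ; d-attained = attained }
      where
      attained : ∀ j → Selected j → ∃[ x′ ] (x′ ∈ varsA (A j) × vdp (σ₀ x′) ≡ vdp (σ₀ x))
      attained j sel = let x′ , x′∈ , x′∈As , x′-top = Equivalence.to (selected⇔top j) sel
                       in x′ , x′∈ , ℤ.≤-antisym (x-top x′ x′∈As) (x′-top x x∈As)

    equation-var-bounded : ∀ j → Selected j → ∀ {v} → var v ∈ termsC Prem →
                           v ∈ varsA (A j) ⊎ v ∈ varsA (B j) → Bounded (σ v)
    equation-var-bounded j sel {v} v∈Prem v∈AB = [ ground-case , top-case ]′ (groundOrTop j sel)
      where
      ground-case : (∀ y → y ∈ varsAs A → Ground (σ₀ y)) → Bounded (σ v)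
      ground-case ground₀ = small⇒bounded v∈Prem (GroundCase.small ground₀ v)
      top-case : TopDepth → Bounded (σ v)
      top-case top = [ NonGroundCase.A-bounded top j sel
                     , (λ v∈B → small⇒bounded v∈Prem (NonGroundCase.B-small top j sel v∈B)) ]′ v∈AB

    var-bounded : ∀ v → var v ∈ termsC Prem → Bounded (σ v)
    var-bounded v v∈Prem with v ∈? EqVars
    ... | no  v∉ = small⇒bounded v∈Prem (outside-small v v∉)
    ... | yes v∈ = let j , sel , v∈AB = ∈-EqVars⁻ v∈ in equation-var-bounded j sel v∈Prem v∈AB

    side-var-small : ∀ j → Selected j → ∀ {g ss} → fun g ss ∈ termsC (Ds j) → ∀ {v} → v ∈ varsV ss → Small v
    side-var-small j sel t∈ {v} v∈ =
      [ (λ ground₀ → GroundCase.small ground₀ v) , (λ top → NonGroundCase.side-small top j sel t∈ v∈) ]′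
        (groundOrTop j sel)

    small-vars-bounded : ∀ {t} → t ∈ termsC Prem → vdp t ≤ℤ 1ℤ → (∀ v → v ∈ varsT t → Small v) →
                         Bounded (subT σ t)
    small-vars-bounded {t} t∈ t≤1 small =
      ℤ.≤-trans (vdp-subT≤vdp σ t small) t≤1 , ℤ.≤-trans (vdp-subT≤vdp σ t small) (vdp≤maxVdp (termsC Prem) t∈)

    main-term-bounded : ∀ {t} → t ∈ termsC (mainPremise A D) → Bounded (subT σ t)
    main-term-bounded {t} t∈ with main-varOrGround t∈
    ... | inj₁ (v , refl) = var-bounded v (main-term∈Prem t∈)
    ... | inj₂ g = small-vars-bounded (main-term∈Prem t∈) (ℤ.≤-trans (ground⇒vdp≤0 t g) 0≤1)
                     (λ v v∈ → ⊥-elim (∉-≡[] g v∈))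

    side-term-bounded : ∀ j → Selected j → ∀ {t} → t ∈ termsC (Ds j) → Bounded (subT σ t)
    side-term-bounded j sel {var v} t∈ = var-bounded v (side-term∈Prem j sel (∈-++⁺ʳ (argsA (B j)) t∈))
    side-term-bounded j sel {fun g ss} t∈ =
      small-vars-bounded (side-term∈Prem j sel (∈-++⁺ʳ (argsA (B j)) t∈)) (All.lookup (simpleDs j) t∈)
        (λ v → side-var-small j sel t∈)

    Body : Clause
    Body = concatMap (λ i → if T i then Ds i else []) (allFin n)
           ++ concatMap (λ i → if T i then [] else neg (A i) ∷ []) (allFin n) ++ D

    body-literal : ∀ {l} → l ∈ Body → l ∈ mainPremise A D ⊎ ∃[ j ] (Selected j × l ∈ Ds j)
    body-literal l∈ with ∈-++⁻ (concatMap (λ i → if T i then Ds i else []) (allFin n)) l∈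
    ... | inj₁ l∈side = let j , _ , l∈j = ∈-concatMap-elim {xs = allFin n} l∈side
                            sel , l∈Ds = ∈-if-true⁻ (T j) l∈j
                        in inj₂ (j , sel , l∈Ds)
    ... | inj₂ l∈rest with ∈-++⁻ (concatMap (λ i → if T i then [] else neg (A i) ∷ []) (allFin n)) l∈rest
    ...   | inj₂ l∈D = inj₁ (∈-++⁺ʳ (map (λ j → neg (A j)) (allFin n)) l∈D)
    ...   | inj₁ l∈unselected with ∈-concatMap-elim {xs = allFin n} l∈unselected
    ...     | i , _ , l∈i with ∈-if-false⁻ (T i) l∈i
    ...       | _ , here refl = inj₁ (negA∈main i)

    resolvent-term-bounded : ∀ {t} → t ∈ termsC (resolvent A D Ds T σ) → Bounded t
    resolvent-term-bounded t∈ with ∈-termsC-subC⁻ σ Body t∈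
    ... | t′ , t′∈ , refl with ∈-termsC⁻ Body t′∈
    ...   | l , l∈ , t′∈l with body-literal l∈
    ...     | inj₁ l∈main            = main-term-bounded (∈-termsC⁺ (mainPremise A D) l∈main t′∈l)
    ...     | inj₂ (j , sel , l∈Ds) = side-term-bounded j sel (∈-termsC⁺ (Ds j) l∈Ds t′∈l)

    no-depth-growth : (vdpC (resolvent A D Ds T σ) ≤ℤ M) × SimpleC (resolvent A D Ds T σ)
    no-depth-growth =
      maxVdp-lub (termsC (resolvent A D Ds T σ)) (-1≤maxVdp (termsC Prem))
        (λ t t∈ → proj₂ (resolvent-term-bounded t∈)) ,
      All.tabulate (λ t∈ → proj₁ (resolvent-term-bounded t∈))

-- The precedence, the selection function and LGC-Refine only restrict which inferences are made, and
-- the flatness of D already follows from the query clause; none of them is needed for the bound.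
corollary2 : (S : Signature) → let open Over S in
    (_≻_ : Sym → Sym → Set) → Precedence _≻_ →
    (sel : Clause → List Literal) →
    (n : ℕ) (A B : Fin n → Atom) (D : Clause) (Ds : Fin n → Clause) (σ₀ : Subst) →
    QueryPair A B σ₀ →
    FlatC D →
    (∀ i → SimpleC (Ds i)) →
    QueryClause (mainPremise A D) →
    (∀ i → LGC (sidePremise B Ds i)) →
    (T : Fin n → Bool) →
    (∀ i → (T i ≡ true) ⇔ ContainsTopVar A σ₀ i) →
    (σ : Subst) → MGUOn (λ i → T i ≡ true) A B σ →
    (∀ i → T i ≡ true → LGCRefine _≻_ sel (B i) (Ds i)) →
    (vdpC (resolvent A D Ds T σ) ≤ℤ vdpC (premises A B D Ds T))
    × SimpleC (resolvent A D Ds T σ)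
corollary2 S _ _ _ n A B D Ds σ₀ queryPair _ simpleDs query lgc T selected⇔top σ mgu _ =
  Inference.no-depth-growth S n A B D Ds σ₀ queryPair simpleDs query lgc T selected⇔top σ mgu
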